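{- Let $C_m$ and $C_n$ be two cycles, and let $f$ be an IASI of the join $C_m+C_n$ whose restrictions to $C_m$ and to $C_n$ are weak IASIs. Then $f$ is a weak IASI of $C_m+C_n$ if and only if all elements (vertices and edges) of $C_m$, or all elements of $C_n$, are mono-indexed under $f$; equivalently, if and only if $C_m$ or $C_n$ is $1$-uniform under $f$.
   Context: All graphs are finite and simple. $\mathbb{N}_0$ denotes the non-negative integers; for $A,B\subseteq\mathbb{N}_0$, $A+B=\{a+b:a\in A,b\in B\}$. An integer additive set-indexer (IASI) of a graph $G$ is an injective map $f:V(G)\to 2^{\mathbb{N}_0}$ such that $g_f:E(G)\to 2^{\mathbb{N}_0}$, $g_f(uv)=f(u)+f(v)$, is injective. A vertex $v$ is mono-indexed if $|f(v)|=1$, an edge $e$ if $|g_f(e)|=1$; a subgraph is $1$-uniform under $f$ if all its edges are mono-indexed. $f$ is a weak IASI if $|g_f(uv)|=\max(|f(u)|,|f(v)|)$ for every edge $uv$. The join $G_1+G_2$ has vertex set $V_1\cup V_2$ and edge set $E_1\cup E_2\cup\{uv:u\in V_1,v\in V_2\}$. -}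

module Defs where

open import Data.Nat using (ℕ; zero; suc; _+_; _∸_; _⊔_)
open import Data.Nat.Properties using (_≟_)
open import Data.Fin using (Fin; toℕ)
open import Data.List using (List; length; map; concatMap; deduplicate)
open import Data.List.Membership.Propositional using (_∈_)
open import Data.Product using (_×_; _,_)
open import Data.Sum using (_⊎_; inj₁; inj₂)
open import Relation.Binary.PropositionalEquality using (_≡_)

-- A (finite) set of non-negative integers, represented by a list of its
-- elements (duplicates and order are irrelevant).
NSet : Set
NSet = List ℕ

_≋_ : NSet → NSet → Set
A ≋ B = ∀ x → (x ∈ A → x ∈ B) × (x ∈ B → x ∈ A)

card : NSet → ℕ
card A = length (deduplicate _≟_ A)

_⊕_ : NSet → NSet → NSet
A ⊕ B = concatMap (λ a → map (a +_) B) A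

record Graph : Set₁ where
  field
    V   : Set
    Adj : V → V → Set

open Graph public

-- two oriented edges u v and u' v' denote the same (unordered) edge
SameEdge : {V : Set} → V → V → V → V → Set
SameEdge u v u' v' = (u ≡ u' × v ≡ v') ⊎ (u ≡ v' × v ≡ u')

gf : {V : Set} → (V → NSet) → V → V → NSet
gf f u v = f u ⊕ f v

IsIASI : (G : Graph) → (V G → NSet) → Set
IsIASI G f =
  (∀ u v → f u ≋ f v → u ≡ v) ×
  (∀ u v u' v' → Adj G u v → Adj G u' v' → gf f u v ≋ gf f u' v' → SameEdge u v u' v')

IsWeakIASI : (G : Graph) → (V G → NSet) → Set
IsWeakIASI G f =
  IsIASI G f × (∀ u v → Adj G u v → card (gf f u v) ≡ card (f u) ⊔ card (f v))

AllMonoIndexed : (G : Graph) → (V G → NSet) → Set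
AllMonoIndexed G f =
  (∀ v → card (f v) ≡ 1) × (∀ u v → Adj G u v → card (gf f u v) ≡ 1)

OneUniform : (G : Graph) → (V G → NSet) → Set
OneUniform G f = ∀ u v → Adj G u v → card (gf f u v) ≡ 1

cycAdj₀ : (m : ℕ) → Fin m → Fin m → Set
cycAdj₀ m i j = (toℕ j ≡ suc (toℕ i)) ⊎ ((toℕ i ≡ m ∸ 1) × (toℕ j ≡ 0))

Cycle : ℕ → Graph
Cycle m = record { V = Fin m ; Adj = λ i j → cycAdj₀ m i j ⊎ cycAdj₀ m j i }

joinAdj : (G H : Graph) → V G ⊎ V H → V G ⊎ V H → Set
joinAdj G H (inj₁ a) (inj₁ b) = Adj G a b
joinAdj G H (inj₂ a) (inj₂ b) = Adj H a b
joinAdj G H (inj₁ a) (inj₂ b) = Data.Unit.⊤ where import Data.Unit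
joinAdj G H (inj₂ a) (inj₁ b) = Data.Unit.⊤ where import Data.Unit

Join : Graph → Graph → Graph
Join G H = record { V = V G ⊎ V H ; Adj = joinAdj G H }

module Submission where

-- The heart of the matter is a fact about sumsets of finite sets of
-- naturals: for non-empty A and B,
--     |A + B| = max(|A|, |B|)   iff   |A| = 1 or |B| = 1.
-- If |B| = 1 then A + B is a translate of A; if |B| ≥ 2, say b₁ < b₂, then
-- A + b₁ together with (max A) + b₂ already gives |A| + 1 distinct sums, so
-- when both sets have at least two elements the sumset exceeds both sizes.
--
-- On the graph side we show that in a weak IASI of a graph
-- in which every vertex has a neighbour other than itself every label is
-- non-empty, and that for such labellings "every vertex is mono-indexed",
-- "every element is mono-indexed" and "1-uniform" coincide.  For a join, the
-- weak condition on the cross edges amounts, by the dichotomy, to one side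
-- having only mono-indexed vertices.

open import Defs
open import Data.Nat using (ℕ; suc; _+_; _⊔_; _≤_; _<_; z≤n; s≤s; _<?_)
open import Data.Sum using (_⊎_; inj₁; inj₂)
open import Data.Product using (_×_; ∃₂; ∃-syntax; _,_; proj₁; proj₂)
open import Function using (_∘_; _⇔_)
open import Data.Nat.Properties
  using (_≟_; ≤-antisym; ≤-pred; <⇒≤; ≮⇒≥; ≤∧≢⇒<; <-irrefl; 1+n≢n; +-comm;
         +-cancelʳ-≡; +-mono-≤-<; ⊔-lub; ⊔-comm; m≤n⇒m⊔n≡n; m≥n⇒m⊔n≡m;
         module ≤-Reasoning)
open import Data.List using (List; []; _∷_; _++_; length; map; deduplicate; cartesianProductWith)
open import Data.List.Properties using (length-map; length-removeAt′)
open import Data.List.Extrema.Nat using (max; xs≤max; argmax-sel)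
open import Data.List.Membership.Propositional using (_∈_)
open import Data.List.Membership.Propositional.Properties
  using (∈-map⁺; ∈-map⁻; ∈-deduplicate⁺; ∈-deduplicate⁻;
         ∈-cartesianProductWith⁺; ∈-cartesianProductWith⁻)
open import Data.List.Relation.Binary.Subset.Propositional using (_⊆_)
open import Data.List.Relation.Unary.Any using (here; there; index; _─_)
open import Data.List.Relation.Unary.All using (All; []; _∷_)
import Data.List.Relation.Unary.All as All
open import Data.List.Relation.Unary.AllPairs using ([]; _∷_)
open import Data.List.Relation.Unary.Unique.Propositional using (Unique)
open import Data.List.Relation.Unary.Unique.Propositional.Properties using (map⁺)
open import Data.List.Relation.Unary.Unique.DecPropositional.Properties _≟_ using (deduplicate-!)
open import Data.Sum.Function.Propositional using (_⊎-⇔_)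
open import Data.Empty using (⊥-elim)
open import Data.Unit using (tt)
open import Data.Fin using (Fin; toℕ; fromℕ<)
open import Data.Fin.Properties using (toℕ-fromℕ<; toℕ<n; all?; ¬∀⟶∃¬)
open import Function.Bundles using (mk⇔; Equivalence)
open import Function.Construct.Composition using (_⇔-∘_)
open import Relation.Nullary using (¬_; yes; no)
open import Relation.Binary.PropositionalEquality
  using (_≡_; _≢_; refl; sym; trans; cong; subst; module ≡-Reasoning)

∈-─⁺ : ∀ {x y : ℕ} {ys} (p : x ∈ ys) → y ∈ ys → y ≢ x → y ∈ (ys ─ p)
∈-─⁺ (here refl) (here refl) y≢x = ⊥-elim (y≢x refl)
∈-─⁺ (here refl) (there q)   _   = q
∈-─⁺ (there p)   (here refl) _   = here refl
∈-─⁺ (there p)   (there q)   y≢x = there (∈-─⁺ p q y≢x)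

unique-⊆⇒length≤ : ∀ {xs ys : List ℕ} → Unique xs → xs ⊆ ys → length xs ≤ length ys
unique-⊆⇒length≤ [] _ = z≤n
unique-⊆⇒length≤ {x ∷ xs} {ys} (x∉xs ∷ xs!) xs⊆ys = begin
  suc (length xs)          ≤⟨ s≤s (unique-⊆⇒length≤ xs! xs⊆ys─x) ⟩
  suc (length (ys ─ x∈ys)) ≡⟨ length-removeAt′ ys (index x∈ys) ⟨
  length ys                ∎
  where
  open ≤-Reasoning
  x∈ys : x ∈ ys
  x∈ys = xs⊆ys (here refl)
  xs⊆ys─x : xs ⊆ (ys ─ x∈ys)
  xs⊆ys─x y∈xs = ∈-─⁺ x∈ys (xs⊆ys (there y∈xs)) (λ y≡x → All.lookup x∉xs y∈xs (sym y≡x))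

length≤card : ∀ {xs A} → Unique xs → xs ⊆ A → length xs ≤ card A
length≤card xs! xs⊆A = unique-⊆⇒length≤ xs! (λ p → ∈-deduplicate⁺ _≟_ (xs⊆A p))

card≤length : ∀ {xs A} → Unique xs → A ⊆ xs → card A ≤ length xs
card≤length {A = A} _ A⊆xs =
  unique-⊆⇒length≤ (deduplicate-! A) (λ p → A⊆xs (∈-deduplicate⁻ _≟_ A p))

card-mono : ∀ {A B} → A ⊆ B → card A ≤ card B
card-mono {A} A⊆B = length≤card (deduplicate-! A) (λ p → A⊆B (∈-deduplicate⁻ _≟_ A p))

Inhabited : NSet → Set
Inhabited A = ∃[ x ] x ∈ A

inhabited⇒card≥1 : ∀ {x A} → x ∈ A → 1 ≤ card A
inhabited⇒card≥1 x∈A = length≤card ([] ∷ []) (λ { (here refl) → x∈A })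

card≡0⇒∉ : ∀ {x A} → card A ≡ 0 → ¬ x ∈ A
card≡0⇒∉ |A|≡0 x∈A = <-irrefl refl (subst (1 ≤_) |A|≡0 (inhabited⇒card≥1 x∈A))

card≡1⇒singleton : ∀ A → card A ≡ 1 → ∃[ b ] b ∈ A × (∀ {x} → x ∈ A → x ≡ b)
card≡1⇒singleton A |A|≡1 with deduplicate _≟_ A in dedup≡ | |A|≡1
... | b ∷ [] | refl =
  b , ∈-deduplicate⁻ _≟_ A (subst (b ∈_) (sym dedup≡) (here refl)) , only-b
  where
  only-b : ∀ {x} → x ∈ A → x ≡ b
  only-b x∈A with subst (_ ∈_) dedup≡ (∈-deduplicate⁺ _≟_ x∈A)
  ... | here x≡b = x≡b

card≥2⇒two-elements : ∀ A → 2 ≤ card A → ∃₂ λ b₁ b₂ → b₁ ∈ A × b₂ ∈ A × b₁ < b₂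
card≥2⇒two-elements A |A|≥2 = lift (two (deduplicate _≟_ A) (deduplicate-! A) |A|≥2)
  where
  two : ∀ xs → Unique xs → 2 ≤ length xs → ∃₂ λ b₁ b₂ → b₁ ∈ xs × b₂ ∈ xs × b₁ < b₂
  two (x ∷ []) _ (s≤s ())
  two (x ∷ y ∷ _) ((x≢y ∷ _) ∷ _) _ with x <? y
  ... | yes x<y = x , y , here refl , there (here refl) , x<y
  ... | no x≮y  = y , x , there (here refl) , here refl ,
                  ≤∧≢⇒< (≮⇒≥ x≮y) (x≢y ∘ sym)
  lift : (∃₂ λ b₁ b₂ → b₁ ∈ deduplicate _≟_ A × b₂ ∈ deduplicate _≟_ A × b₁ < b₂) →
         ∃₂ λ b₁ b₂ → b₁ ∈ A × b₂ ∈ A × b₁ < b₂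
  lift (b₁ , b₂ , p₁ , p₂ , b₁<b₂) =
    b₁ , b₂ , ∈-deduplicate⁻ _≟_ A p₁ , ∈-deduplicate⁻ _≟_ A p₂ , b₁<b₂

-- The sumset is the cartesian product of A and B under addition; this lets us
-- reuse the library's membership lemmas for cartesian products.
⊕≡cartesianProduct : ∀ A B → A ⊕ B ≡ cartesianProductWith _+_ A B
⊕≡cartesianProduct []      B = refl
⊕≡cartesianProduct (a ∷ A) B = cong (_ ++_) (⊕≡cartesianProduct A B)

∈-⊕⁺ : ∀ {a b A B} → a ∈ A → b ∈ B → a + b ∈ A ⊕ B
∈-⊕⁺ {A = A} {B} a∈A b∈B =
  subst (_ ∈_) (sym (⊕≡cartesianProduct A B)) (∈-cartesianProductWith⁺ _+_ a∈A b∈B)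

∈-⊕⁻ : ∀ {x} A B → x ∈ A ⊕ B → ∃₂ λ a b → a ∈ A × b ∈ B × x ≡ a + b
∈-⊕⁻ A B x∈A⊕B =
  ∈-cartesianProductWith⁻ _+_ A B (subst (_ ∈_) (⊕≡cartesianProduct A B) x∈A⊕B)

⊕-comm-⊆ : ∀ A B → A ⊕ B ⊆ B ⊕ A
⊕-comm-⊆ A B x∈A⊕B with ∈-⊕⁻ A B x∈A⊕B
... | a , b , a∈A , b∈B , refl = subst (_∈ B ⊕ A) (+-comm b a) (∈-⊕⁺ b∈B a∈A)

card-⊕-comm : ∀ A B → card (A ⊕ B) ≡ card (B ⊕ A)
card-⊕-comm A B = ≤-antisym (card-mono (⊕-comm-⊆ A B)) (card-mono (⊕-comm-⊆ B A))

translate : NSet → ℕ → List ℕ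
translate A b = map (_+ b) (deduplicate _≟_ A)

translate-unique : ∀ A b → Unique (translate A b)
translate-unique A b = map⁺ (λ {x} {y} → +-cancelʳ-≡ b x y) (deduplicate-! A)

length-translate : ∀ A b → length (translate A b) ≡ card A
length-translate A b = length-map (_+ b) (deduplicate _≟_ A)

∈-translate⁺ : ∀ {a} A b → a ∈ A → a + b ∈ translate A b
∈-translate⁺ A b a∈A = ∈-map⁺ (_+ b) (∈-deduplicate⁺ _≟_ a∈A)

translate-⊆ : ∀ {b} A B → b ∈ B → translate A b ⊆ A ⊕ B
translate-⊆ A B b∈B x∈A+b with ∈-map⁻ _ x∈A+b
... | a , a∈A , refl = ∈-⊕⁺ (∈-deduplicate⁻ _≟_ A a∈A) b∈B

card≤card-⊕ : ∀ {b} A B → b ∈ B → card A ≤ card (A ⊕ B)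
card≤card-⊕ {b} A B b∈B = subst (_≤ card (A ⊕ B)) (length-translate A b)
  (length≤card (translate-unique A b) (translate-⊆ A B b∈B))

-- Adding a singleton is a translation: if |B| = 1 then |A + B| = |A|.
card-⊕-singleton : ∀ A B → card B ≡ 1 → card (A ⊕ B) ≡ card A
card-⊕-singleton A B |B|≡1 with card≡1⇒singleton B |B|≡1
... | b , b∈B , only-b = ≤-antisym
  (subst (card (A ⊕ B) ≤_) (length-translate A b)
    (card≤length (translate-unique A b) A⊕B⊆A+b))
  (card≤card-⊕ A B b∈B)
  where
  A⊕B⊆A+b : A ⊕ B ⊆ translate A b
  A⊕B⊆A+b x∈A⊕B with ∈-⊕⁻ A B x∈A⊕B
  ... | a , b′ , a∈A , b′∈B , refl rewrite only-b b′∈B = ∈-translate⁺ A b a∈A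

-- Growth: if A is non-empty and |B| ≥ 2 then |A + B| > |A|.  With b₁ < b₂ in B
-- and M the maximum of A, the sum M + b₂ lies outside the translate A + b₁.
card-⊕-grows : ∀ {x} A B → x ∈ A → 2 ≤ card B → card A < card (A ⊕ B)
card-⊕-grows {x} A B x∈A |B|≥2 with card≥2⇒two-elements B |B|≥2
... | b₁ , b₂ , b₁∈B , b₂∈B , b₁<b₂ =
  subst (λ k → suc k ≤ card (A ⊕ B)) (length-translate A b₁)
    (length≤card (M+b₂∉A+b₁ ∷ translate-unique A b₁) sums⊆A⊕B)
  where
  M : ℕ
  M = max x A
  M∈A : M ∈ A
  M∈A with argmax-sel (λ y → y) x A
  ... | inj₁ M≡x = subst (_∈ A) (sym M≡x) x∈A
  ... | inj₂ max∈A = max∈A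
  M+b₂∉A+b₁ : All (M + b₂ ≢_) (translate A b₁)
  M+b₂∉A+b₁ = All.tabulate beyond
    where
    beyond : ∀ {y} → y ∈ translate A b₁ → M + b₂ ≢ y
    beyond y∈A+b₁ M+b₂≡y with ∈-map⁻ _ y∈A+b₁
    ... | a , a∈A , refl = <-irrefl (sym M+b₂≡y)
      (+-mono-≤-< (All.lookup (xs≤max x A) (∈-deduplicate⁻ _≟_ A a∈A)) b₁<b₂)
  sums⊆A⊕B : (M + b₂ ∷ translate A b₁) ⊆ A ⊕ B
  sums⊆A⊕B (here refl) = ∈-⊕⁺ M∈A b₂∈B
  sums⊆A⊕B (there p)   = translate-⊆ A B b₁∈B p

max<card-⊕ : ∀ {x y} A B → x ∈ A → y ∈ B → 2 ≤ card A → 2 ≤ card B →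
  card A ⊔ card B < card (A ⊕ B)
max<card-⊕ A B x∈A y∈B |A|≥2 |B|≥2 = ⊔-lub (card-⊕-grows A B x∈A |B|≥2)
  (subst (card B <_) (card-⊕-comm B A) (card-⊕-grows B A y∈B |A|≥2))

weak-sum⇔singleton-summand : ∀ {x y} A B → x ∈ A → y ∈ B →
  (card (A ⊕ B) ≡ card A ⊔ card B) ⇔ (card A ≡ 1 ⊎ card B ≡ 1)
weak-sum⇔singleton-summand A B x∈A y∈B = mk⇔ weak⇒singleton singleton⇒weak
  where
  at-least-2 : ∀ {z} C → z ∈ C → card C ≢ 1 → 2 ≤ card C
  at-least-2 C z∈C |C|≢1 = ≤∧≢⇒< (inhabited⇒card≥1 z∈C) (|C|≢1 ∘ sym)
  weak⇒singleton : card (A ⊕ B) ≡ card A ⊔ card B → card A ≡ 1 ⊎ card B ≡ 1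
  weak⇒singleton weak with card A ≟ 1 | card B ≟ 1
  ... | yes |A|≡1 | _        = inj₁ |A|≡1
  ... | no _      | yes |B|≡1 = inj₂ |B|≡1
  ... | no |A|≢1  | no |B|≢1  = ⊥-elim (<-irrefl (sym weak)
    (max<card-⊕ A B x∈A y∈B (at-least-2 A x∈A |A|≢1) (at-least-2 B y∈B |B|≢1)))
  singleton⇒weak : card A ≡ 1 ⊎ card B ≡ 1 → card (A ⊕ B) ≡ card A ⊔ card B
  singleton⇒weak (inj₁ |A|≡1) = begin
    card (A ⊕ B)     ≡⟨ card-⊕-comm A B ⟩
    card (B ⊕ A)     ≡⟨ card-⊕-singleton B A |A|≡1 ⟩
    card B           ≡⟨ m≤n⇒m⊔n≡n (inhabited⇒card≥1 y∈B) ⟨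
    1 ⊔ card B       ≡⟨ cong (_⊔ card B) |A|≡1 ⟨
    card A ⊔ card B  ∎
    where open ≡-Reasoning
  singleton⇒weak (inj₂ |B|≡1) = begin
    card (A ⊕ B)     ≡⟨ card-⊕-singleton A B |B|≡1 ⟩
    card A           ≡⟨ m≥n⇒m⊔n≡m (inhabited⇒card≥1 x∈A) ⟨
    card A ⊔ 1       ≡⟨ cong (card A ⊔_) |B|≡1 ⟨
    card A ⊔ card B  ∎
    where open ≡-Reasoning

card-⊕≡1⇒card≡1 : ∀ {x y} A B → x ∈ A → y ∈ B → card (A ⊕ B) ≡ 1 → card A ≡ 1
card-⊕≡1⇒card≡1 A B x∈A y∈B |A⊕B|≡1 =
  ≤-antisym (subst (card A ≤_) |A⊕B|≡1 (card≤card-⊕ A B y∈B)) (inhabited⇒card≥1 x∈A)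

HasDistinctNeighbours : Graph → Set
HasDistinctNeighbours G = ∀ v → ∃[ w ] Adj G v w × v ≢ w

cycle-hasDistinctNeighbours : ∀ {m} → 2 ≤ m → HasDistinctNeighbours (Cycle m)
cycle-hasDistinctNeighbours {m} _ i with suc (toℕ i) <? m
... | yes i+1<m = fromℕ< i+1<m , inj₁ (inj₁ (toℕ-fromℕ< i+1<m)) , i≢i+1
  where
  i≢i+1 : i ≢ fromℕ< i+1<m
  i≢i+1 i≡i+1 = 1+n≢n (trans (sym (toℕ-fromℕ< i+1<m)) (cong toℕ (sym i≡i+1)))
cycle-hasDistinctNeighbours {suc m} (s≤s 1≤m) i | no i+1≮m =
  Fin.zero , inj₁ (inj₂ (i≡m , refl)) , i≢0
  where
  i≡m : toℕ i ≡ m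
  i≡m = ≤-antisym (≤-pred (toℕ<n i)) (≤-pred (≮⇒≥ i+1≮m))
  i≢0 : i ≢ Fin.zero
  i≢0 refl = <-irrefl refl (subst (1 ≤_) (sym i≡m) 1≤m)

-- In a weak IASI no vertex with a distinct neighbour w carries the empty set:
-- ∅ + f(w) = ∅, so weakness would force |f(w)| = 0, making f(v) = f(w) = ∅
-- against injectivity.
weak⇒labels-inhabited : ∀ G {f : V G → NSet} → HasDistinctNeighbours G →
  IsWeakIASI G f → ∀ v → Inhabited (f v)
weak⇒labels-inhabited G {f} neighbour ((injective , _) , weak) v with f v in fv≡∅
... | x ∷ _ = x , here refl
... | []    with neighbour v
...   | w , v~w , v≢w = ⊥-elim (v≢w (injective v w fv≋fw))
  where
  |fv|≡0 : card (f v) ≡ 0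
  |fv|≡0 = cong card fv≡∅
  |fw|≡0 : card (f w) ≡ 0
  |fw|≡0 = sym (subst (λ A → card (A ⊕ f w) ≡ card A ⊔ card (f w)) fv≡∅ (weak v w v~w))
  fv≋fw : f v ≋ f w
  fv≋fw z = (λ z∈fv → ⊥-elim (card≡0⇒∉ |fv|≡0 z∈fv)) ,
            (λ z∈fw → ⊥-elim (card≡0⇒∉ |fw|≡0 z∈fw))

VerticesMonoIndexed : {A : Set} → (A → NSet) → Set
VerticesMonoIndexed g = ∀ a → card (g a) ≡ 1

verticesMono⇔allMonoIndexed : ∀ G (f : V G → NSet) →
  VerticesMonoIndexed f ⇔ AllMonoIndexed G f
verticesMono⇔allMonoIndexed G f = mk⇔ (λ mono → mono , edgesMono mono) proj₁
  where
  edgesMono : VerticesMonoIndexed f → OneUniform G f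
  edgesMono mono u v _ = trans (card-⊕-singleton (f u) (f v) (mono v)) (mono u)

-- For a weak IASI of a graph with distinct neighbours, 1-uniformity already
-- forces every vertex to be mono-indexed: each vertex lies on a mono-indexed edge.
verticesMono⇔oneUniform : ∀ G (f : V G → NSet) → HasDistinctNeighbours G →
  IsWeakIASI G f → VerticesMonoIndexed f ⇔ OneUniform G f
verticesMono⇔oneUniform G f neighbour weak =
  mk⇔ (proj₂ ∘ Equivalence.to (verticesMono⇔allMonoIndexed G f)) uniform⇒mono
  where
  inhabited : ∀ v → Inhabited (f v)
  inhabited = weak⇒labels-inhabited G neighbour weak
  uniform⇒mono : OneUniform G f → VerticesMonoIndexed f
  uniform⇒mono uniform v with neighbour v
  ... | w , v~w , _ = card-⊕≡1⇒card≡1 (f v) (f w)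
    (proj₂ (inhabited v)) (proj₂ (inhabited w)) (uniform v w v~w)

CrossWeak : {A B : Set} → (A → NSet) → (B → NSet) → Set
CrossWeak g h = ∀ a b → card (g a ⊕ h b) ≡ card (g a) ⊔ card (h b)

joinWeak⇔crossWeak : ∀ G H {f : V (Join G H) → NSet} →
  IsIASI (Join G H) f → IsWeakIASI G (f ∘ inj₁) → IsWeakIASI H (f ∘ inj₂) →
  IsWeakIASI (Join G H) f ⇔ CrossWeak (f ∘ inj₁) (f ∘ inj₂)
joinWeak⇔crossWeak G H {f} iasi (_ , weakG) (_ , weakH) =
  mk⇔ (λ (_ , weak) a b → weak (inj₁ a) (inj₂ b) tt) (λ cross → iasi , weakEdge cross)
  where
  weakEdge : CrossWeak (f ∘ inj₁) (f ∘ inj₂) →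
    ∀ u v → Adj (Join G H) u v → card (gf f u v) ≡ card (f u) ⊔ card (f v)
  weakEdge _     (inj₁ a) (inj₁ b) a~b = weakG a b a~b
  weakEdge _     (inj₂ a) (inj₂ b) a~b = weakH a b a~b
  weakEdge cross (inj₁ a) (inj₂ b) _   = cross a b
  weakEdge cross (inj₂ b) (inj₁ a) _   = begin
    card (f (inj₂ b) ⊕ f (inj₁ a))          ≡⟨ card-⊕-comm (f (inj₂ b)) (f (inj₁ a)) ⟩
    card (f (inj₁ a) ⊕ f (inj₂ b))          ≡⟨ cross a b ⟩
    card (f (inj₁ a)) ⊔ card (f (inj₂ b))   ≡⟨ ⊔-comm (card (f (inj₁ a))) _ ⟩
    card (f (inj₂ b)) ⊔ card (f (inj₁ a))   ∎
    where open ≡-Reasoning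

-- By the sumset dichotomy, the cross edges between two families of non-empty
-- sets (the first indexed by a finite type) are weak iff one family consists
-- of singletons: if some g(a) is not a singleton, every h(b) must be one.
crossWeak⇔oneSideMono : ∀ {k} {B : Set} (g : Fin k → NSet) (h : B → NSet) →
  (∀ a → Inhabited (g a)) → (∀ b → Inhabited (h b)) →
  CrossWeak g h ⇔ (VerticesMonoIndexed g ⊎ VerticesMonoIndexed h)
crossWeak⇔oneSideMono {k} g h inhabitedG inhabitedH = mk⇔ cross⇒mono mono⇒cross
  where
  dichotomy : ∀ a b → (card (g a ⊕ h b) ≡ card (g a) ⊔ card (h b))
                    ⇔ (card (g a) ≡ 1 ⊎ card (h b) ≡ 1)
  dichotomy a b = weak-sum⇔singleton-summand (g a) (h b)
    (proj₂ (inhabitedG a)) (proj₂ (inhabitedH b))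
  cross⇒mono : CrossWeak g h → VerticesMonoIndexed g ⊎ VerticesMonoIndexed h
  cross⇒mono cross with all? (λ a → card (g a) ≟ 1)
  ... | yes monoG = inj₁ monoG
  ... | no ¬monoG with ¬∀⟶∃¬ k _ (λ a → card (g a) ≟ 1) ¬monoG
  ...   | a , |ga|≢1 = inj₂ monoH
    where
    monoH : VerticesMonoIndexed h
    monoH b with Equivalence.to (dichotomy a b) (cross a b)
    ... | inj₁ |ga|≡1 = ⊥-elim (|ga|≢1 |ga|≡1)
    ... | inj₂ |hb|≡1 = |hb|≡1
  mono⇒cross : VerticesMonoIndexed g ⊎ VerticesMonoIndexed h → CrossWeak g h
  mono⇒cross (inj₁ monoG) a b = Equivalence.from (dichotomy a b) (inj₁ (monoG a))
  mono⇒cross (inj₂ monoH) a b = Equivalence.from (dichotomy a b) (inj₂ (monoH b))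

mainTheorem7 : (m n : ℕ) → 3 ≤ m → 3 ≤ n →
    (f : V (Join (Cycle m) (Cycle n)) → NSet) →
    IsIASI (Join (Cycle m) (Cycle n)) f →
    IsWeakIASI (Cycle m) (f ∘ inj₁) →
    IsWeakIASI (Cycle n) (f ∘ inj₂) →
    (IsWeakIASI (Join (Cycle m) (Cycle n)) f
      ⇔ (AllMonoIndexed (Cycle m) (f ∘ inj₁) ⊎ AllMonoIndexed (Cycle n) (f ∘ inj₂)))
    × (IsWeakIASI (Join (Cycle m) (Cycle n)) f
      ⇔ (OneUniform (Cycle m) (f ∘ inj₁) ⊎ OneUniform (Cycle n) (f ∘ inj₂)))
mainTheorem7 m n 3≤m 3≤n f iasi weakₘ weakₙ =
    (verticesMono⇔allMonoIndexed Cₘ (f ∘ inj₁) ⊎-⇔ verticesMono⇔allMonoIndexed Cₙ (f ∘ inj₂))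
      ⇔-∘ weak⇔oneSideMono
  , (verticesMono⇔oneUniform Cₘ (f ∘ inj₁) neighbourₘ weakₘ
       ⊎-⇔ verticesMono⇔oneUniform Cₙ (f ∘ inj₂) neighbourₙ weakₙ)
      ⇔-∘ weak⇔oneSideMono
  where
  Cₘ Cₙ : Graph
  Cₘ = Cycle m
  Cₙ = Cycle n
  neighbourₘ : HasDistinctNeighbours Cₘ
  neighbourₘ = cycle-hasDistinctNeighbours (<⇒≤ 3≤m)
  neighbourₙ : HasDistinctNeighbours Cₙ
  neighbourₙ = cycle-hasDistinctNeighbours (<⇒≤ 3≤n)
  weak⇔oneSideMono : IsWeakIASI (Join Cₘ Cₙ) f ⇔
    (VerticesMonoIndexed (f ∘ inj₁) ⊎ VerticesMonoIndexed (f ∘ inj₂))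
  weak⇔oneSideMono =
    crossWeak⇔oneSideMono (f ∘ inj₁) (f ∘ inj₂)
      (weak⇒labels-inhabited Cₘ neighbourₘ weakₘ)
      (weak⇒labels-inhabited Cₙ neighbourₙ weakₙ)
    ⇔-∘ joinWeak⇔crossWeak Cₘ Cₙ iasi weakₘ weakₙ
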